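{- Let $G$ be a group, $A={\rm Aut}(G)$, $g\in G$ and $\sigma\in S_G$. Define $\bar g,\widetilde g,\tau,\widehat\sigma:{\mathbb Z}_2\times G\to{\mathbb Z}_2\times G$ by $\bar g(0,x)=(0,x)$, $\bar g(1,x)=(1,xg^{ -1})$; $\widetilde g(0,x)=(0,xg^{ -1})$, $\widetilde g(1,x)=(1,x)$; $\tau(i,j)=(i+1,j)$; $\widehat\sigma(i,j)=(i,\sigma(j))$. Set $\bar G=\{\bar g:g\in G\}$, $\widetilde G=\{\widetilde g:g\in G\}$ and $\widehat A=\{\widehat a:a\in A\}$. Then $\widetilde g=\tau^{ -1}\bar g\tau$ for all $g\in G$, $\bar G$ and $\widetilde G$ are groups with $\widetilde G\bar G\cong G\times G$, and $$N_{S_{{\mathbb Z}_2\times G}}(\widehat G_L)={\langle}\tau{\rangle}\cdot\widehat A\cdot(\widetilde G\bar G).$$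
   Context: Permutations compose right to left. For $g\in G$, $\widehat g_L:{\mathbb Z}_2\times G\to{\mathbb Z}_2\times G$ is $\widehat g_L(i,x)=(i,gx)$, and $\widehat G_L=\{\widehat g_L:g\in G\}$. $N_{S_{{\mathbb Z}_2\times G}}(\widehat G_L)$ denotes the normalizer of $\widehat G_L$ in the symmetric group on ${\mathbb Z}_2\times G$. -}

module Defs where

open import Data.Fin using (Fin; zero; suc)
open import Data.Product using (Σ; ∃; ∃-syntax; _×_; _,_; proj₁; proj₂)
open import Data.Sum using (_⊎_)
open import Function using (_∘_; id)
open import Function.Bundles using (_↔_; Inverse)
open import Relation.Binary.PropositionalEquality using (_≡_)
open import Algebra.Core using (Op₁; Op₂)
open import Algebra.Structures using (IsGroup)

record GroupStr : Set₁ where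
  infixl 7 _∙_
  infix 8 _⁻¹
  field
    Carrier : Set
    _∙_     : Op₂ Carrier
    ε       : Carrier
    _⁻¹     : Op₁ Carrier
    isGroup : IsGroup _≡_ _∙_ ε _⁻¹

Z2 : Set
Z2 = Fin 2

flip2 : Z2 → Z2
flip2 zero = suc zero
flip2 (suc zero) = zero

_≐_ : {X : Set} → (X → X) → (X → X) → Set
f ≐ g = ∀ p → f p ≡ g p

module Constructions (𝔾 : GroupStr) where
  open GroupStr 𝔾 renaming (Carrier to G)

  Pt : Set
  Pt = Z2 × G

  Perm : Set
  Perm = Pt ↔ Pt

  IsAut : (G ↔ G) → Set
  IsAut a = ∀ x y → Inverse.to a (x ∙ y) ≡ Inverse.to a x ∙ Inverse.to a y

  hatL : G → Pt → Pt
  hatL g (i , x) = (i , g ∙ x)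

  bar : G → Pt → Pt
  bar g (zero , x) = (zero , x)
  bar g (suc zero , x) = (suc zero , x ∙ g ⁻¹)

  tilde : G → Pt → Pt
  tilde g (zero , x) = (zero , x ∙ g ⁻¹)
  tilde g (suc zero , x) = (suc zero , x)

  -- τ and τ⁻¹ (τ is an involution; τinv is its inverse written out)
  τ : Pt → Pt
  τ (i , j) = (flip2 i , j)

  τinv : Pt → Pt
  τinv (i , j) = (flip2 i , j)

  -- τ^k for k ∈ {0,1} (⟨τ⟩ = {id, τ} since τ² = id)
  τpow : Fin 2 → Pt → Pt
  τpow zero = id
  τpow (suc zero) = τ

  hatσ : (G → G) → Pt → Pt
  hatσ σ (i , j) = (i , σ j)

  InNormalizer : Perm → Set
  InNormalizer σ =
    (∀ g → ∃[ h ] ((Inverse.to σ ∘ hatL g ∘ Inverse.from σ) ≐ hatL h)) ×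
    (∀ h → ∃[ g ] ((Inverse.to σ ∘ hatL g ∘ Inverse.from σ) ≐ hatL h))

  InProduct : Perm → Set
  InProduct σ =
    Σ (Fin 2) λ k → Σ (G ↔ G) λ a → (IsAut a × ∃[ t ] ∃[ b ]
      (Inverse.to σ ≐ (τpow k ∘ hatσ (Inverse.to a) ∘ tilde t ∘ bar b)))

  IsSubgroupFam : {I : Set} → (I → Pt → Pt) → Set
  IsSubgroupFam {I} f =
    (∃[ e ] (f e ≐ id)) ×
    (∀ i j → ∃[ k ] ((f i ∘ f j) ≐ f k)) ×
    (∀ i → ∃[ k ] (((f i ∘ f k) ≐ id) × ((f k ∘ f i) ≐ id)))

  _⊗_ : G × G → G × G → G × G
  (g , h) ⊗ (g' , h') = (g ∙ g' , h ∙ h')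

  TildeBarIsoGxG : Set
  TildeBarIsoGxG =
    Σ (G × G → Pt → Pt) λ φ → (
      (∀ p q → φ (p ⊗ q) ≐ (φ p ∘ φ q)) ×
      (∀ p q → φ p ≐ φ q → p ≡ q) ×
      (∀ (f : Pt → Pt) →
        ((∃[ t ] ∃[ b ] (f ≐ (tilde t ∘ bar b))) → ∃[ p ] (f ≐ φ p)) ×
        ((∃[ p ] (f ≐ φ p)) → ∃[ t ] ∃[ b ] (f ≐ (tilde t ∘ bar b)))))

{-# OPTIONS --safe #-}
module Submission where

-- A permutation s of ℤ₂ × G normalises Ĝ_L exactly when s ∘ ĝ_L = (α g)_L ∘ s for a
-- bijection α of G, and such an α is forced to be an automorphism.  Evaluating at the
-- points (i , e) gives s (i , x) = s (x_L (i , e)) = (j i , α x · y i), where j is a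
-- permutation of ℤ₂ (a power of τ) because s is injective and α surjective.  So s is a
-- power of τ after α̂ after a right translation on each fibre, and these translations are
-- exactly what G̃ Ḡ supplies.  Conversely τ, Â, G̃ and Ḡ all conjugate ĝ_L to (α g)_L
-- (with α = id except on Â), hence so does their product.

open import Defs
open import Algebra.Bundles using (Group)
open import Data.Empty using (⊥-elim)
open import Data.Fin using (Fin; zero; suc)
open import Data.Fin.Properties using (0≢1+n)
open import Data.Product using (Σ; ∃-syntax; _×_; _,_; proj₁; proj₂)
open import Function using (_∘_; id)
open import Function.Bundles using (_↔_; Inverse; Injection; mk↔ₛ′)
open import Function.Definitions using (Injective)
open import Function.Properties.Inverse using (↔⇒↣)
open import Relation.Binary.PropositionalEquality
  using (_≡_; _≢_; refl; sym; trans; cong; cong₂; subst; module ≡-Reasoning)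

module Normalizer (𝔾 : GroupStr) where
  open GroupStr 𝔾 renaming (Carrier to G)
  open Constructions 𝔾
  open Inverse using (to; from; strictlyInverseˡ; strictlyInverseʳ)

  group : Group _ _
  group = record { isGroup = isGroup }

  open Group group using (assoc; identityʳ; inverseˡ; inverseʳ)
  open import Algebra.Properties.Group group
    using ( ε⁻¹≈ε; ⁻¹-involutive; ⁻¹-injective; ⁻¹-anti-homo-∙
          ; ∙-cancelˡ; ∙-cancelʳ; //-rightDividesˡ)
  open ≡-Reasoning

  ∙⁻¹-ε : ∀ x → x ∙ ε ⁻¹ ≡ x
  ∙⁻¹-ε x = trans (cong (x ∙_) ε⁻¹≈ε) (identityʳ x)

  ∙⁻¹-∙ : ∀ x g h → x ∙ (g ∙ h) ⁻¹ ≡ (x ∙ h ⁻¹) ∙ g ⁻¹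
  ∙⁻¹-∙ x g h = trans (cong (x ∙_) (⁻¹-anti-homo-∙ g h)) (sym (assoc x (h ⁻¹) (g ⁻¹)))

  tilde≐τinv∘bar∘τ : ∀ g → tilde g ≐ (τinv ∘ bar g ∘ τ)
  tilde≐τinv∘bar∘τ g (zero , x) = refl
  tilde≐τinv∘bar∘τ g (suc zero , x) = refl

  homomorphic⇒isSubgroupFam : (f : G → Pt → Pt) →
    f ε ≐ id → (∀ g h → f (g ∙ h) ≐ (f g ∘ f h)) → IsSubgroupFam f
  homomorphic⇒isSubgroupFam f f-ε f-∙ =
    (ε , f-ε) ,
    (λ g h → g ∙ h , λ p → sym (f-∙ g h p)) ,
    (λ g → g ⁻¹ , inverse-pair g (g ⁻¹) (inverseʳ g) , inverse-pair (g ⁻¹) g (inverseˡ g))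
    where
    inverse-pair : ∀ g h → g ∙ h ≡ ε → (f g ∘ f h) ≐ id
    inverse-pair g h gh≡ε p = begin
      f g (f h p)  ≡⟨ f-∙ g h p ⟨
      f (g ∙ h) p  ≡⟨ cong (λ u → f u p) gh≡ε ⟩
      f ε p        ≡⟨ f-ε p ⟩
      p            ∎

  bar-isSubgroupFam : IsSubgroupFam bar
  bar-isSubgroupFam = homomorphic⇒isSubgroupFam bar bar-ε bar-∙
    where
    bar-ε : bar ε ≐ id
    bar-ε (zero , x) = refl
    bar-ε (suc zero , x) = cong (suc zero ,_) (∙⁻¹-ε x)
    bar-∙ : ∀ g h → bar (g ∙ h) ≐ (bar g ∘ bar h)
    bar-∙ g h (zero , x) = refl
    bar-∙ g h (suc zero , x) = cong (suc zero ,_) (∙⁻¹-∙ x g h)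

  tilde-isSubgroupFam : IsSubgroupFam tilde
  tilde-isSubgroupFam = homomorphic⇒isSubgroupFam tilde tilde-ε tilde-∙
    where
    tilde-ε : tilde ε ≐ id
    tilde-ε (zero , x) = cong (zero ,_) (∙⁻¹-ε x)
    tilde-ε (suc zero , x) = refl
    tilde-∙ : ∀ g h → tilde (g ∙ h) ≐ (tilde g ∘ tilde h)
    tilde-∙ g h (zero , x) = cong (zero ,_) (∙⁻¹-∙ x g h)
    tilde-∙ g h (suc zero , x) = refl

  tildeBar : G × G → Pt → Pt
  tildeBar (t , b) = tilde t ∘ bar b

  tildeBar-⊗ : ∀ p q → tildeBar (p ⊗ q) ≐ (tildeBar p ∘ tildeBar q)
  tildeBar-⊗ (t , b) (t' , b') (zero , x) = cong (zero ,_) (∙⁻¹-∙ x t t')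
  tildeBar-⊗ (t , b) (t' , b') (suc zero , x) = cong (suc zero ,_) (∙⁻¹-∙ x b b')

  tildeBar-injective : ∀ p q → tildeBar p ≐ tildeBar q → p ≡ q
  tildeBar-injective (t , b) (t' , b') e =
    cong₂ _,_ (ε∙⁻¹-injective (cong proj₂ (e (zero , ε))))
              (ε∙⁻¹-injective (cong proj₂ (e (suc zero , ε))))
    where
    ε∙⁻¹-injective : ∀ {g h} → ε ∙ g ⁻¹ ≡ ε ∙ h ⁻¹ → g ≡ h
    ε∙⁻¹-injective eq = ⁻¹-injective (∙-cancelˡ ε _ _ eq)

  tildeBar≅G×G : TildeBarIsoGxG
  tildeBar≅G×G = tildeBar , tildeBar-⊗ , tildeBar-injective ,
    λ f → (λ { (t , b , e) → (t , b) , e }) , (λ { ((t , b) , e) → t , b , e })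

  Conjugates : (Pt → Pt) → G → G → Set
  Conjugates s g h = (s ∘ hatL g) ≐ (hatL h ∘ s)

  hatL-∙ : ∀ g h → (hatL g ∘ hatL h) ≐ hatL (g ∙ h)
  hatL-∙ g h (i , x) = cong (i ,_) (sym (assoc g h x))

  hatL-ε : ∀ i x → hatL x (i , ε) ≡ (i , x)
  hatL-ε i x = cong (i ,_) (identityʳ x)

  hatL-injective : ∀ {g h} p → hatL g p ≡ hatL h p → g ≡ h
  hatL-injective (i , x) e = ∙-cancelʳ x _ _ (cong proj₂ e)

  conjugates-∙ : ∀ {s g h g' h'} →
    Conjugates s g h → Conjugates s g' h' → Conjugates s (g ∙ g') (h ∙ h')
  conjugates-∙ {s} {g} {h} {g'} {h'} c c' p = begin
    s (hatL (g ∙ g') p)     ≡⟨ cong s (hatL-∙ g g' p) ⟨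
    s (hatL g (hatL g' p))  ≡⟨ c (hatL g' p) ⟩
    hatL h (s (hatL g' p))  ≡⟨ cong (hatL h) (c' p) ⟩
    hatL h (hatL h' (s p))  ≡⟨ hatL-∙ h h' (s p) ⟩
    hatL (h ∙ h') (s p)     ∎

  conjugates-∘ : ∀ {s s' g h k} →
    Conjugates s' g h → Conjugates s h k → Conjugates (s ∘ s') g k
  conjugates-∘ {s} c' c p = trans (cong s (c' p)) (c _)

  conjugates-resp-≐ : ∀ {s s' g h} → s ≐ s' → Conjugates s' g h → Conjugates s g h
  conjugates-resp-≐ {h = h} s≐s' c p =
    trans (s≐s' _) (trans (c p) (cong (hatL h) (sym (s≐s' p))))

  conjugate-unique : ∀ {s g h h'} → Conjugates s g h → Conjugates s g h' → h ≡ h'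
  conjugate-unique {s} c c' = hatL-injective (s (zero , ε)) (trans (sym (c _)) (c' _))

  conjugator-unique : ∀ {s g g' h} → Injective _≡_ _≡_ s →
    Conjugates s g h → Conjugates s g' h → g ≡ g'
  conjugator-unique s-injective c c' =
    hatL-injective (zero , ε) (s-injective (trans (c _) (sym (c' _))))

  conjugating⇒affine : ∀ {s} {α : G → G} → (∀ g → Conjugates s g (α g)) →
    ∀ i x → s (i , x) ≡ hatL (α x) (s (i , ε))
  conjugating⇒affine {s} c i x = trans (cong s (sym (hatL-ε i x))) (c x (i , ε))

  τpow-conjugates : ∀ k g → Conjugates (τpow k) g g
  τpow-conjugates zero g p = refl
  τpow-conjugates (suc zero) g p = refl

  hatσ-conjugates : ∀ {α} → (∀ x y → α (x ∙ y) ≡ α x ∙ α y) →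
    ∀ g → Conjugates (hatσ α) g (α g)
  hatσ-conjugates α-∙ g (i , x) = cong (i ,_) (α-∙ g x)

  tilde-conjugates : ∀ t g → Conjugates (tilde t) g g
  tilde-conjugates t g (zero , x) = cong (zero ,_) (assoc g x (t ⁻¹))
  tilde-conjugates t g (suc zero , x) = refl

  bar-conjugates : ∀ b g → Conjugates (bar b) g g
  bar-conjugates b g (zero , x) = refl
  bar-conjugates b g (suc zero , x) = cong (suc zero ,_) (assoc g x (b ⁻¹))

  conjugates⇒to∘hatL∘from : ∀ (σ : Perm) {g h} → Conjugates (to σ) g h →
    (to σ ∘ hatL g ∘ from σ) ≐ hatL h
  conjugates⇒to∘hatL∘from σ {h = h} c p = trans (c _) (cong (hatL h) (strictlyInverseˡ σ p))

  to∘hatL∘from⇒conjugates : ∀ (σ : Perm) {g h} → (to σ ∘ hatL g ∘ from σ) ≐ hatL h →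
    Conjugates (to σ) g h
  to∘hatL∘from⇒conjugates σ {g} c p =
    trans (cong (to σ ∘ hatL g) (sym (strictlyInverseʳ σ p))) (c _)

  to-injective : (σ : Perm) → Injective _≡_ _≡_ (to σ)
  to-injective σ = Injection.injective (↔⇒↣ σ)

  ConjugatesByAut : Perm → Set
  ConjugatesByAut σ =
    Σ (G ↔ G) λ a → IsAut a × (∀ g → Conjugates (to σ) g (to a g))

  normalizer⇒conjugatesByAut : ∀ σ → InNormalizer σ → ConjugatesByAut σ
  normalizer⇒conjugatesByAut σ (forth , back) = mk↔ₛ′ α β α∘β β∘α , α-∙ , α-conj
    where
    α β : G → G
    α g = proj₁ (forth g)
    β h = proj₁ (back h)
    α-conj : ∀ g → Conjugates (to σ) g (α g)
    α-conj g = to∘hatL∘from⇒conjugates σ (proj₂ (forth g))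
    β-conj : ∀ h → Conjugates (to σ) (β h) h
    β-conj h = to∘hatL∘from⇒conjugates σ (proj₂ (back h))
    α∘β : ∀ h → α (β h) ≡ h
    α∘β h = conjugate-unique (α-conj (β h)) (β-conj h)
    β∘α : ∀ g → β (α g) ≡ g
    β∘α g = conjugator-unique (to-injective σ) (β-conj (α g)) (α-conj g)
    α-∙ : ∀ x y → α (x ∙ y) ≡ α x ∙ α y
    α-∙ x y = conjugate-unique (α-conj (x ∙ y)) (conjugates-∙ (α-conj x) (α-conj y))

  conjugatesByAut⇒normalizer : ∀ σ → ConjugatesByAut σ → InNormalizer σ
  conjugatesByAut⇒normalizer σ (a , _ , c) =
    (λ g → to a g , conjugates⇒to∘hatL∘from σ (c g)) ,
    (λ h → from a h , conjugates⇒to∘hatL∘from σ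
      (subst (Conjugates (to σ) _) (strictlyInverseˡ a h) (c (from a h))))

  product⇒conjugatesByAut : ∀ σ → InProduct σ → ConjugatesByAut σ
  product⇒conjugatesByAut σ (k , a , a-∙ , t , b , σ≐) = a , a-∙ , λ g →
    conjugates-resp-≐ σ≐
      (conjugates-∘ (conjugates-∘ (conjugates-∘ (bar-conjugates b g) (tilde-conjugates t g))
                                  (hatσ-conjugates a-∙ g))
                    (τpow-conjugates k _))

  fibres-distinct : ∀ {s} (a : G ↔ G) → Injective _≡_ _≡_ s →
    (∀ g → Conjugates s g (to a g)) → proj₁ (s (zero , ε)) ≢ proj₁ (s (suc zero , ε))
  fibres-distinct {s} a s-injective c j₀≡j₁ =
    0≢1+n (cong proj₁ (s-injective (sym collision)))
    where
    y₀ y₁ : G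
    y₀ = proj₂ (s (zero , ε))
    y₁ = proj₂ (s (suc zero , ε))
    collision : s (suc zero , from a (y₀ ∙ y₁ ⁻¹)) ≡ s (zero , ε)
    collision = begin
      s (suc zero , from a (y₀ ∙ y₁ ⁻¹))
        ≡⟨ conjugating⇒affine c (suc zero) _ ⟩
      (proj₁ (s (suc zero , ε)) , to a (from a (y₀ ∙ y₁ ⁻¹)) ∙ y₁)
        ≡⟨ cong₂ _,_ (sym j₀≡j₁) (cong (_∙ y₁) (strictlyInverseˡ a _)) ⟩
      (proj₁ (s (zero , ε)) , (y₀ ∙ y₁ ⁻¹) ∙ y₁)
        ≡⟨ cong (proj₁ (s (zero , ε)) ,_) (//-rightDividesˡ y₁ y₀) ⟩
      s (zero , ε)
        ∎

  τpow-realises : (j : Z2 → Z2) → j zero ≢ j (suc zero) →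
    ∃[ k ] (∀ i x → τpow k (i , x) ≡ (j i , x))
  τpow-realises j j-distinct with j zero in e₀ | j (suc zero) in e₁
  ... | zero     | zero     = ⊥-elim (j-distinct refl)
  ... | suc zero | suc zero = ⊥-elim (j-distinct refl)
  ... | zero     | suc zero =
    zero , λ { zero x → cong (_, x) (sym e₀) ; (suc zero) x → cong (_, x) (sym e₁) }
  ... | suc zero | zero     =
    suc zero , λ { zero x → cong (_, x) (sym e₀) ; (suc zero) x → cong (_, x) (sym e₁) }

  affine⇒product : ∀ σ (a : G ↔ G) → IsAut a → (k : Fin 2) (y : Z2 → G) →
    (∀ i x → to σ (i , x) ≡ τpow k (i , to a x ∙ y i)) → InProduct σ
  affine⇒product σ a a-∙ k y σ-affine =
    k , a , a-∙ , translation (y zero) , translation (y (suc zero)) , σ≐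
    where
    α : G → G
    α = to a
    translation : G → G
    translation z = from a z ⁻¹
    α-translation : ∀ x z → α (x ∙ translation z ⁻¹) ≡ α x ∙ z
    α-translation x z = begin
      α (x ∙ from a z ⁻¹ ⁻¹)    ≡⟨ cong (α ∘ (x ∙_)) (⁻¹-involutive _) ⟩
      α (x ∙ from a z)          ≡⟨ a-∙ x _ ⟩
      α x ∙ α (from a z)        ≡⟨ cong (α x ∙_) (strictlyInverseˡ a z) ⟩
      α x ∙ z                           ∎
    fibre : ∀ i x → to σ (i , x) ≡ τpow k (i , α (x ∙ translation (y i) ⁻¹))
    fibre i x = trans (σ-affine i x) (cong (τpow k ∘ (i ,_)) (sym (α-translation x (y i))))
    σ≐ : to σ ≐
         (τpow k ∘ hatσ α ∘ tilde (translation (y zero)) ∘ bar (translation (y (suc zero))))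
    σ≐ (zero , x) = fibre zero x
    σ≐ (suc zero , x) = fibre (suc zero) x

  conjugatesByAut⇒product : ∀ σ → ConjugatesByAut σ → InProduct σ
  conjugatesByAut⇒product σ (a , a-∙ , c) =
    let k , τpow-k = τpow-realises (proj₁ ∘ s-at-ε) (fibres-distinct a (to-injective σ) c)
    in affine⇒product σ a a-∙ k (proj₂ ∘ s-at-ε) λ i x →
         trans (conjugating⇒affine c i x) (sym (τpow-k i _))
    where
    s-at-ε : Z2 → Pt
    s-at-ε i = to σ (i , ε)

mainTheorem3 : (𝔾 : GroupStr) → let open Constructions 𝔾 in
    (∀ g → tilde g ≐ (τinv ∘ bar g ∘ τ))
    × IsSubgroupFam bar
    × IsSubgroupFam tilde
    × TildeBarIsoGxG
    × (∀ (σ : Perm) → (InNormalizer σ → InProduct σ) × (InProduct σ → InNormalizer σ))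
mainTheorem3 𝔾 =
  tilde≐τinv∘bar∘τ , bar-isSubgroupFam , tilde-isSubgroupFam , tildeBar≅G×G ,
  λ σ → conjugatesByAut⇒product σ ∘ normalizer⇒conjugatesByAut σ ,
        conjugatesByAut⇒normalizer σ ∘ product⇒conjugatesByAut σ
  where open Normalizer 𝔾
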